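{- Let $d\geq 5$ and let $\Sigma$ be the simplicial complex constructed below. Then $\Sigma$ is simply connected.
   Context: Construction of $\Sigma$. Use vertices $x_1,\dots,x_d,y_1,\dots,y_d,x'_1,\dots,x'_d,y'_1,\dots,y'_d$, with indices cyclic ($x_{d+j}=x_j$ etc.); give $x_j,y_j,x'_j,y'_j$ color $j$. Let $\partial P$ (resp. $\partial P'$) be the boundary complex of the $d$-cross-polytope on $\{x_j,y_j\}$ (resp. $\{x'_j,y'_j\}$), whose faces are subsets containing no pair $\{x_j,y_j\}$ (resp. $\{x'_j,y'_j\}$). For $1\le i\le d$ let $\sigma_i=\{x_1,\dots,x_i,y_{i+1},\dots,y_d\}$ and $\sigma_{d+i}=\{y_1,\dots,y_i,x_{i+1},\dots,x_d\}$; let $\Delta_1\subseteq\partial P$ be generated by $\sigma_1,\dots,\sigma_{2d}$ and $\Delta_2$ be generated by the remaining facets of $\partial P$. Let $f:\partial P\to\partial P'$ be the simplicial isomorphism induced by $x_i\mapsto x'_{i+1}$, $y_i\mapsto y'_{i+1}$ ($1\le i\le d-1$), $x_d\mapsto y'_1$, $y_d\mapsto x'_1$. For $1\le i\le 2d$ let $\Gamma_i$ be the boundary complex of the $d$-cross-polytope on vertex set $\sigma_i\cup f(\sigma_i)$ in which each vertex of $\sigma_i$ is antipodal to the vertex of $f(\sigma_i)$ of the same color. Define edges $e_i=\{x'_{i+1},y_{i+2}\}$ and $e_{d+i}=\{y'_{i+1},x_{i+2}\}$ for $1\le i\le d-2$, $e_{d-1}=\{x'_d,x_1\}$, $e_d=\{y'_1,x_2\}$,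 $e_{2d-1}=\{y'_d,y_1\}$, $e_{2d}=\{x'_1,y_2\}$ (so that $\Gamma_i\cap\Gamma_{i+1}=\mathrm{st}(e_i,\Gamma_i)$, indices mod $2d$). Let $\Gamma$ be the complex generated by all facets of $\Gamma_1,\dots,\Gamma_{2d}$ that contain neither $e_{i-1}$ nor $e_i$ when taken in $\Gamma_i$ (indices mod $2d$); $\Gamma$ contains $\Delta_1$ and $f(\Delta_1)$. Let $N$ be generated by the facets of $\Gamma$ not belonging to $\Delta_1\cup f(\Delta_1)$. Finally $\Sigma$ is the complex generated by the facets of $\Delta_2$, $N$ and $f(\Delta_2)$ (so $\Sigma=\Delta_2\cup_{\partial\Delta_1}N\cup_{\partial f(\Delta_1)}f(\Delta_2)$). -}

module Defs where

open import Level using (0ℓ)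
open import Data.Nat using (ℕ; zero; suc; _+_; _*_; _∸_; _≤_; NonZero; _<ᵇ_; _≤ᵇ_; _≡ᵇ_)
open import Data.Nat.DivMod using (_%_; m%n<n)
open import Data.Fin using (Fin; toℕ; fromℕ<)
open import Data.Bool using (Bool; true; false; not; if_then_else_)
open import Data.Product using (Σ; ∃; _×_; _,_; proj₂)
open import Data.Sum using (_⊎_; inj₁; inj₂)
open import Data.Empty using (⊥)
open import Data.List using (List; []; _∷_; _++_)
open import Relation.Nullary using (¬_)
open import Relation.Unary using (Pred; _∈_; _⊆_)
open import Relation.Binary.PropositionalEquality using (_≡_)
open import Relation.Binary.Construct.Closure.Equivalence using (EqClosure)

-- A simplicial complex on vertex type V, presented by a family of
-- generating facets (each facet a set of vertices); its faces are the
-- subsets of generating facets.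
record Complex (V : Set) : Set₁ where
  field
    Idx   : Set
    facet : Idx → Pred V 0ℓ

module _ {V : Set} (K : Complex V) where
  open Complex K

  IsVertex : V → Set
  IsVertex v = ∃ λ i → v ∈ facet i

  Adjacent : V → V → Set
  Adjacent u v = ∃ λ i → u ∈ facet i × v ∈ facet i

  InSimplex3 : V → V → V → Set
  InSimplex3 a b c = ∃ λ i → a ∈ facet i × b ∈ facet i × c ∈ facet i

  data EdgePath : List V → Set where
    [_]ᵉ : ∀ {v} → IsVertex v → EdgePath (v ∷ [])
    _∷ᵉ_ : ∀ {u v p} → Adjacent u v → EdgePath (v ∷ p) → EdgePath (u ∷ v ∷ p)

  data ElemMove : List V → List V → Set where
    contract  : ∀ p a b c q → InSimplex3 a b c →
                ElemMove (p ++ a ∷ b ∷ c ∷ q) (p ++ a ∷ c ∷ q)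
    unstutter : ∀ p a q → IsVertex a →
                ElemMove (p ++ a ∷ a ∷ q) (p ++ a ∷ q)

  EdgePathEquiv : List V → List V → Set
  EdgePathEquiv = EqClosure ElemMove

  SimplyConnected : Set
  SimplyConnected =
    (∃ IsVertex)
    × (∀ u v → IsVertex u → IsVertex v → ∃ λ p → EdgePath (u ∷ p ++ v ∷ []))
    × (∀ v p → EdgePath (v ∷ p ++ v ∷ []) →
         EdgePathEquiv (v ∷ p ++ v ∷ []) (v ∷ []))

data Kind : Set where
  X Y X′ Y′ : Kind

-- vertex (k , j) : kind k, colour j; Fin value j stands for paper index toℕ j + 1
Vertex : ℕ → Set
Vertex d = Kind × Fin d

module Construction (d : ℕ) .{{_ : NonZero d}} where

  -- paper index i (1-based, cyclic mod d) as an element of Fin d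
  ix : ℕ → Fin d
  ix i = fromℕ< (m%n<n (i + (d ∸ 1)) d)

  x y x′ y′ : ℕ → Vertex d
  x  i = X  , ix i
  y  i = Y  , ix i
  x′ i = X′ , ix i
  y′ i = Y′ , ix i

  colour : Vertex d → Fin d
  colour = proj₂

  -- facet of ∂P picking x_j (true) or y_j (false) in each colour j
  PFacet : (Fin d → Bool) → Pred (Vertex d) 0ℓ
  PFacet c (X , j) = c j ≡ true
  PFacet c (Y , j) = c j ≡ false
  PFacet c (_ , _) = ⊥

  σChoice : ℕ → Fin d → Bool
  σChoice i j = if i ≤ᵇ d then toℕ j <ᵇ i else not (toℕ j <ᵇ (i ∸ d))

  σ : ℕ → Pred (Vertex d) 0ℓ
  σ i = PFacet (σChoice i)

  InRange : ℕ → Set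
  InRange i = 1 ≤ i × i ≤ 2 * d

  -- the isomorphism f : ∂P → ∂P' (on primed vertices it is irrelevant;
  -- it is only ever applied to vertices of ∂P)
  f : Vertex d → Vertex d
  f (X , j) = if suc (toℕ j) <ᵇ d then (X′ , ix (toℕ j + 2)) else (Y′ , ix 1)
  f (Y , j) = if suc (toℕ j) <ᵇ d then (Y′ , ix (toℕ j + 2)) else (X′ , ix 1)
  f v = v

  image : Pred (Vertex d) 0ℓ → Pred (Vertex d) 0ℓ
  image S v = ∃ λ u → u ∈ S × f u ≡ v

  InΔ1 : Pred (Vertex d) 0ℓ → Set
  InΔ1 S = ∃ λ k → InRange k × S ⊆ σ k

  InfΔ1 : Pred (Vertex d) 0ℓ → Set
  InfΔ1 S = ∃ λ k → InRange k × S ⊆ image (σ k)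

  -- facets of Γ_i: in each colour choose the vertex of σ_i (true) or
  -- the vertex of f(σ_i) (false) of that colour
  ΓFacet : ℕ → (Fin d → Bool) → Pred (Vertex d) 0ℓ
  ΓFacet i b v = (v ∈ σ i × b (colour v) ≡ true) ⊎ (v ∈ image (σ i) × b (colour v) ≡ false)

  -- the edges e_k, 1 ≤ k ≤ 2d; e_0 := e_{2d} (cyclic indexing)
  e : ℕ → Vertex d × Vertex d
  e k =
    if k ≡ᵇ 0 then (x′ 1 , y 2)
    else if k <ᵇ d ∸ 1 then (x′ (k + 1) , y (k + 2))
    else if k ≡ᵇ d ∸ 1 then (x′ d , x 1)
    else if k ≡ᵇ d then (y′ 1 , x 2)
    else if k <ᵇ 2 * d ∸ 1 then (y′ ((k ∸ d) + 1) , x ((k ∸ d) + 2))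
    else if k ≡ᵇ 2 * d ∸ 1 then (y′ d , y 1)
    else (x′ 1 , y 2)

  ContainsEdge : Pred (Vertex d) 0ℓ → Vertex d × Vertex d → Set
  ContainsEdge F (a , b) = a ∈ F × b ∈ F

  IsΓFacet : ℕ → (Fin d → Bool) → Set
  IsΓFacet i b = InRange i × ¬ ContainsEdge (ΓFacet i b) (e (i ∸ 1))
                           × ¬ ContainsEdge (ΓFacet i b) (e i)

  NIdx : Set
  NIdx = Σ ℕ λ i → Σ (Fin d → Bool) λ b →
           IsΓFacet i b × ¬ (InΔ1 (ΓFacet i b) ⊎ InfΔ1 (ΓFacet i b))

  Δ2Idx : Set
  Δ2Idx = Σ (Fin d → Bool) λ c → ¬ InΔ1 (PFacet c)

  SigmaIdx : Set
  SigmaIdx = Δ2Idx ⊎ (NIdx ⊎ Δ2Idx)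

  sigmaFacet : SigmaIdx → Pred (Vertex d) 0ℓ
  sigmaFacet (inj₁ (c , _))          = PFacet c
  sigmaFacet (inj₂ (inj₁ (i , b , _))) = ΓFacet i b
  sigmaFacet (inj₂ (inj₂ (c , _)))   = image (PFacet c)

  Sigma : Complex (Vertex d)
  Sigma = record { Idx = SigmaIdx ; facet = sigmaFacet }

{-# OPTIONS --safe #-}
-- Call the vertices of ∂P unprimed and those of ∂P′ primed. Every edge path in Σ can be
-- pushed off the primed vertices: a primed vertex a next to an unprimed one is replaced by
-- f⁻¹(a), which spans a triangle of N with both of its neighbours, and two adjacent primed
-- vertices always have a common unprimed neighbour in N (the Γ-facets needed exist once
-- d ≥ 5).
-- The unprimed part is then coned off at x₁: two unprimed vertices of distinct colours
-- other than 1 span a triangle of Δ2 with x₁ (or y₁), since a choice of x's and y's that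
-- switches twice is none of the σ_i; y₁ itself is reached from x₁ through x₂.
module Submission where

open import Data.Bool using (Bool; true; false; not; _∨_; if_then_else_)
open import Data.Bool.Properties using (T-≡; not-injective; ∨-conicalʳ; ∨-zeroʳ; ¬-not; not-¬)
import Data.Bool.Properties as Bool
open import Data.Empty using (⊥-elim)
open import Data.Fin using (Fin; toℕ; _≟_)
import Data.Fin as Fin
open import Data.Fin.Patterns using (0F; 1F; 2F)
open import Data.Fin.Properties using (toℕ-fromℕ<; toℕ-injective; toℕ<n; all?; ¬∀⟶∃¬; pigeonhole)
import Data.Fin.Properties as Finₚ
open import Data.List using (List; []; _∷_; _++_; length; lookup)
open import Data.List.Properties using (++-assoc)
open import Data.List.Relation.Unary.All using (All; []; _∷_)
open import Data.List.Relation.Unary.All.Properties using (¬Any⇒All¬)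
open import Data.List.Relation.Unary.Any using (any?; index)
open import Data.List.Relation.Unary.Any.Properties using (lookup-index)
open import Data.Nat
  using (ℕ; zero; suc; _+_; _*_; _∸_; _≤_; _<_; z≤n; s≤s; z<s; NonZero; _<ᵇ_; _≤ᵇ_; _≡ᵇ_; _<?_; _≤?_)
open import Data.Nat.DivMod using (_%_; m%n<n; m<n⇒m%n≡m; m≤n⇒[n∸m]%m≡n%m; %-distribˡ-+; [m+n]%n≡m%n)
open import Data.Nat.Properties
  using ( ≤-refl; ≤-trans; ≤-antisym; <-trans; <-cmp; <⇒≤; <⇒≢; <⇒≱; ≤⇒≯; ≮⇒≥; ≰⇒>; ≤∧≢⇒<; n≤1+n
        ; n≢0⇒n>0; suc-injective; +-comm; +-assoc; +-suc; +-identityʳ; m≤m+n; m<m+n; m<n+m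
        ; +-monoʳ-≤; +-monoˡ-<; m+n∸m≡n; m∸n+n≡m; m∸n≤m; ∸-monoˡ-<
        ; <⇒<ᵇ; ≡ᵇ⇒≡; ≡⇒≡ᵇ; <ᵇ-reflects-<; ≤ᵇ-reflects-≤ )
open import Data.Product using (∃; _×_; _,_; proj₁; proj₂)
open import Data.Sum using (_⊎_; inj₁; inj₂)
open import Data.Vec.Functional using (updateAt)
open import Data.Vec.Functional.Properties using (updateAt-updates; updateAt-minimal)
open import Function using (_∘_; const)
open import Function.Bundles using (Equivalence)
open import Relation.Binary.Construct.Closure.ReflexiveTransitive using (Star; ε; _◅_; _◅◅_; reverse)
open import Relation.Binary.Construct.Closure.Symmetric using (fwd; bwd)
import Relation.Binary.Construct.Closure.Equivalence as EqClosure
open import Relation.Binary.Definitions using (tri<; tri≈; tri>)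
open import Relation.Binary.PropositionalEquality
  using (_≡_; _≢_; refl; sym; trans; cong; cong₂; subst; subst₂; module ≡-Reasoning)
open import Relation.Nullary using (¬_; yes; no; does; contradiction)
open import Relation.Nullary.Decidable using (dec-true; dec-false; _⊎-dec_; _×-dec_)
open import Relation.Nullary.Reflects using (Reflects; ofʸ; ofⁿ; fromEquivalence)
open import Relation.Unary using (Decidable; _∈_; _⊆_)

open import Defs

-- Edge-path equivalence

module EdgePathAlgebra {V : Set} (K : Complex V) where

  infix 4 _~_
  _~_ : List V → List V → Set
  _~_ = EdgePathEquiv K

  open import Relation.Binary.Reasoning.Setoid (EqClosure.setoid (ElemMove K)) public
    using (begin_; _∎; step-≈-⟩; step-≈-⟨; step-≡-⟨)

  adjacent-sym : ∀ {a b} → Adjacent K a b → Adjacent K b a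
  adjacent-sym (i , a∈ , b∈) = i , b∈ , a∈

  adjacent-refl : ∀ {a} → IsVertex K a → Adjacent K a a
  adjacent-refl (i , a∈) = i , a∈ , a∈

  adjacent⇒isVertexˡ : ∀ {a b} → Adjacent K a b → IsVertex K a
  adjacent⇒isVertexˡ (i , a∈ , _) = i , a∈

  adjacent⇒isVertexʳ : ∀ {a b} → Adjacent K a b → IsVertex K b
  adjacent⇒isVertexʳ (i , _ , b∈) = i , b∈

  simplex3-rotate : ∀ {a b c} → InSimplex3 K a b c → InSimplex3 K b c a
  simplex3-rotate (i , a∈ , b∈ , c∈) = i , b∈ , c∈ , a∈

  simplex3-swap : ∀ {a b c} → InSimplex3 K a b c → InSimplex3 K b a c
  simplex3-swap (i , a∈ , b∈ , c∈) = i , b∈ , a∈ , c∈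

  simplex3-adj₁₂ : ∀ {a b c} → InSimplex3 K a b c → Adjacent K a b
  simplex3-adj₁₂ (i , a∈ , b∈ , _) = i , a∈ , b∈

  simplex3-adj₁₃ : ∀ {a b c} → InSimplex3 K a b c → Adjacent K a c
  simplex3-adj₁₃ (i , a∈ , _ , c∈) = i , a∈ , c∈

  simplex3-adj₂₃ : ∀ {a b c} → InSimplex3 K a b c → Adjacent K b c
  simplex3-adj₂₃ (i , _ , b∈ , c∈) = i , b∈ , c∈

  adjacent⇒simplex3ʳ : ∀ {a b} → Adjacent K a b → InSimplex3 K a b b
  adjacent⇒simplex3ʳ (i , a∈ , b∈) = i , a∈ , b∈ , b∈

  ~-contract : ∀ p q {a b c} → InSimplex3 K a b c → (p ++ a ∷ b ∷ c ∷ q) ~ (p ++ a ∷ c ∷ q)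
  ~-contract p q t = fwd (contract p _ _ _ q t) ◅ ε

  ~-expand : ∀ p q {a b c} → InSimplex3 K a b c → (p ++ a ∷ c ∷ q) ~ (p ++ a ∷ b ∷ c ∷ q)
  ~-expand p q t = bwd (contract p _ _ _ q t) ◅ ε

  ~-unstutter : ∀ p q {a} → IsVertex K a → (p ++ a ∷ a ∷ q) ~ (p ++ a ∷ q)
  ~-unstutter p q a∈ = fwd (unstutter p _ q a∈) ◅ ε

  ~-backtrack : ∀ p q {a b} → Adjacent K a b → (p ++ a ∷ b ∷ a ∷ q) ~ (p ++ a ∷ q)
  ~-backtrack p q (i , a∈ , b∈) =
    ~-contract p q (i , a∈ , b∈ , a∈) ◅◅ ~-unstutter p q (i , a∈)

  ~-prefix : ∀ p {l l′} → l ~ l′ → (p ++ l) ~ (p ++ l′)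
  ~-prefix p = EqClosure.gmap (p ++_) move
    where
    move : ∀ {l l′} → ElemMove K l l′ → ElemMove K (p ++ l) (p ++ l′)
    move (contract r a b c q t) =
      subst₂ (ElemMove K) (++-assoc p r _) (++-assoc p r _) (contract (p ++ r) a b c q t)
    move (unstutter r a q a∈) =
      subst₂ (ElemMove K) (++-assoc p r _) (++-assoc p r _) (unstutter (p ++ r) a q a∈)

  ~-suffix : ∀ q {l l′} → l ~ l′ → (l ++ q) ~ (l′ ++ q)
  ~-suffix q = EqClosure.gmap (_++ q) move
    where
    move : ∀ {l l′} → ElemMove K l l′ → ElemMove K (l ++ q) (l′ ++ q)
    move (contract r a b c s t) =
      subst₂ (ElemMove K) (sym (++-assoc r _ q)) (sym (++-assoc r _ q)) (contract r a b c (s ++ q) t)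
    move (unstutter r a s a∈) =
      subst₂ (ElemMove K) (sym (++-assoc r _ q)) (sym (++-assoc r _ q)) (unstutter r a (s ++ q) a∈)

  ~-cancelˡ : ∀ {a b} xs ys → Adjacent K a b → (a ∷ b ∷ xs) ~ (a ∷ b ∷ ys) → (b ∷ xs) ~ (b ∷ ys)
  ~-cancelˡ {a} {b} xs ys ab eq = begin
    b ∷ xs            ≈⟨ ~-backtrack [] xs (adjacent-sym ab) ⟨
    b ∷ a ∷ b ∷ xs    ≈⟨ ~-prefix (b ∷ []) eq ⟩
    b ∷ a ∷ b ∷ ys    ≈⟨ ~-backtrack [] ys (adjacent-sym ab) ⟩
    b ∷ ys            ∎

  ~-cancel-walk : ∀ p {v} xs ys → EdgePath K (p ++ v ∷ []) →
                  (p ++ v ∷ xs) ~ (p ++ v ∷ ys) → (v ∷ xs) ~ (v ∷ ys)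
  ~-cancel-walk []            xs ys _             eq = eq
  ~-cancel-walk (a ∷ [])      xs ys (av ∷ᵉ _)    eq = ~-cancelˡ xs ys av eq
  ~-cancel-walk (a ∷ b ∷ p)   xs ys (ab ∷ᵉ path) eq =
    ~-cancel-walk (b ∷ p) xs ys path (~-cancelˡ (p ++ _ ∷ xs) (p ++ _ ∷ ys) ab eq)

  ~-conjugate : ∀ {a n} p → Adjacent K a n →
                (n ∷ (a ∷ p ++ a ∷ []) ++ n ∷ []) ~ (n ∷ []) → (a ∷ p ++ a ∷ []) ~ (a ∷ [])
  ~-conjugate {a} {n} p an loop = begin
    a ∷ p ++ a ∷ []                          ≈⟨ ~-backtrack [] _ an ⟨
    a ∷ n ∷ a ∷ p ++ a ∷ []                  ≈⟨ ~-backtrack (a ∷ n ∷ a ∷ p) [] an ⟨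
    a ∷ n ∷ a ∷ p ++ a ∷ n ∷ a ∷ []          ≡⟨ cong (λ l → a ∷ n ∷ a ∷ l) reassoc ⟨
    a ∷ (n ∷ (a ∷ p ++ a ∷ []) ++ n ∷ []) ++ a ∷ []  ≈⟨ ~-prefix (a ∷ []) (~-suffix (a ∷ []) loop) ⟩
    a ∷ n ∷ a ∷ []                           ≈⟨ ~-backtrack [] [] an ⟩
    a ∷ []                                   ∎
    where
    reassoc : ((p ++ a ∷ []) ++ n ∷ []) ++ a ∷ [] ≡ p ++ a ∷ n ∷ a ∷ []
    reassoc = trans (++-assoc (p ++ a ∷ []) _ _) (++-assoc p _ _)

  ~-flip : ∀ s t {a b} → Adjacent K a b → (∀ rest → (s ++ a ∷ b ∷ rest) ~ (t ++ b ∷ rest)) →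
           ∀ rest → (t ++ b ∷ a ∷ rest) ~ (s ++ a ∷ rest)
  ~-flip s t {a} {b} ab move rest = begin
    t ++ b ∷ a ∷ rest        ≈⟨ move (a ∷ rest) ⟨
    s ++ a ∷ b ∷ a ∷ rest    ≈⟨ ~-backtrack s rest ab ⟩
    s ++ a ∷ rest            ∎

  edgePath-head : ∀ {v l} → EdgePath K (v ∷ l) → IsVertex K v
  edgePath-head [ v∈ ]ᵉ    = v∈
  edgePath-head (vw ∷ᵉ _) = adjacent⇒isVertexˡ vw

  edgePath-snoc : ∀ u p {v w} → EdgePath K (u ∷ p ++ v ∷ []) → Adjacent K v w →
                  EdgePath K ((u ∷ p ++ v ∷ []) ++ w ∷ [])
  edgePath-snoc u []      (uv ∷ᵉ _)    vw = uv ∷ᵉ (vw ∷ᵉ [ adjacent⇒isVertexʳ vw ]ᵉ)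
  edgePath-snoc u (x ∷ p) (ux ∷ᵉ path) vw = ux ∷ᵉ edgePath-snoc x p path vw

  Walk : V → V → Set
  Walk = Star (Adjacent K)

  vertices⁻ : ∀ {u v} → Walk u v → List V
  vertices⁻ ε              = []
  vertices⁻ (_◅_ {u} _ w) = u ∷ vertices⁻ w

  edgePath-◅ : ∀ {u w v} → Adjacent K u w → (walk : Walk w v) →
               EdgePath K (u ∷ vertices⁻ walk ++ v ∷ [])
  edgePath-◅ uw ε           = uw ∷ᵉ [ adjacent⇒isVertexʳ uw ]ᵉ
  edgePath-◅ uw (wx ◅ walk) = uw ∷ᵉ edgePath-◅ wx walk

  walk⇒edgePath : ∀ {u v} → IsVertex K v → (walk : Walk u v) → EdgePath K (vertices⁻ walk ++ v ∷ [])
  walk⇒edgePath v∈ ε           = [ v∈ ]ᵉ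
  walk⇒edgePath _  (uw ◅ walk) = edgePath-◅ uw walk

  walk⇒path : ∀ {u v} → IsVertex K u → Walk u v → ∃ λ p → EdgePath K (u ∷ p ++ v ∷ [])
  walk⇒path u∈ ε           = [] , adjacent-refl u∈ ∷ᵉ [ u∈ ]ᵉ
  walk⇒path _  (uw ◅ walk) = vertices⁻ walk , edgePath-◅ uw walk

-- Simple connectivity from a cone of good vertices

record ConeRetract {V : Set} (K : Complex V) : Set₁ where
  open EdgePathAlgebra K
  field
    Good         : V → Set
    good?        : Decidable Good
    lift         : V → V
    lift-good    : ∀ {a} → ¬ Good a → Good (lift a)
    lift-simplex : ∀ {m a} → Good m → ¬ Good a → Adjacent K m a → InSimplex3 K m (lift a) a
    bridge       : ∀ {a b} → ¬ Good a → ¬ Good b → Adjacent K a b →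
                   ∃ λ n → Good n × InSimplex3 K a n b
    base         : V
    base-vertex  : IsVertex K base
    spine        : ∀ {v} → Good v → Walk base v
    -- the loop formed by the spines of m and v and the edge m v is null-homotopic
    spine-move   : ∀ {m v} (gm : Good m) (gv : Good v) → Adjacent K m v → ∀ rest →
                   (vertices⁻ (spine gm) ++ m ∷ v ∷ rest) ~ (vertices⁻ (spine gv) ++ v ∷ rest)

module _ {V : Set} {K : Complex V} (C : ConeRetract K) where
  open EdgePathAlgebra K
  open ConeRetract C

  private
    trail : ∀ {v} → Good v → List V
    trail gv = vertices⁻ (spine gv)

  detour : ∀ {v w} → ¬ Good v → Adjacent K v w → ∃ λ n → Good n × InSimplex3 K v n w
  detour {w = w} ¬gv vw with good? w
  ... | yes gw  = w , gw , adjacent⇒simplex3ʳ vw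
  ... | no ¬gw = bridge ¬gv ¬gw vw

  bypass : ∀ {m v n w} (gm : Good m) → ¬ Good v → (gn : Good n) → Adjacent K m v →
           InSimplex3 K v n w → ∀ rest →
           (trail gm ++ m ∷ v ∷ w ∷ rest) ~ (trail gn ++ n ∷ w ∷ rest)
  bypass {m} {v} {n} {w} gm ¬gv gn mv vnw rest = begin
    trail gm ++ m ∷ v ∷ w ∷ rest                 ≈⟨ ~-prefix (trail gm) (~-expand (m ∷ []) rest vnw) ⟩
    trail gm ++ m ∷ v ∷ n ∷ w ∷ rest             ≈⟨ ~-expand (trail gm) (n ∷ w ∷ rest) mlv ⟩
    trail gm ++ m ∷ lift v ∷ v ∷ n ∷ w ∷ rest    ≈⟨ ~-prefix (trail gm) (~-contract (m ∷ []) (w ∷ rest) lvn) ⟩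
    trail gm ++ m ∷ lift v ∷ n ∷ w ∷ rest        ≈⟨ spine-move gm gl (simplex3-adj₁₂ mlv) (n ∷ w ∷ rest) ⟩
    trail gl ++ lift v ∷ n ∷ w ∷ rest            ≈⟨ spine-move gl gn (simplex3-adj₁₃ lvn) (w ∷ rest) ⟩
    trail gn ++ n ∷ w ∷ rest                     ∎
    where
    gl : Good (lift v)
    gl = lift-good ¬gv
    mlv : InSimplex3 K m (lift v) v
    mlv = lift-simplex gm ¬gv mv
    lvn : InSimplex3 K (lift v) v n
    lvn = simplex3-rotate (lift-simplex gn ¬gv (adjacent-sym (simplex3-adj₁₂ vnw)))

  spine-path : ∀ {m w} (gm : Good m) (gw : Good w) p → EdgePath K (m ∷ p ++ w ∷ []) →
               (trail gm ++ m ∷ p ++ w ∷ []) ~ (trail gw ++ w ∷ [])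
  spine-path gm gw [] (mw ∷ᵉ _) = spine-move gm gw mw []
  spine-path gm gw (v ∷ p) (mv ∷ᵉ path) with good? v
  ... | yes gv = spine-move gm gv mv (p ++ _ ∷ []) ◅◅ spine-path gv gw p path
  spine-path gm gw (v ∷ []) (mv ∷ᵉ (vw ∷ᵉ _)) | no ¬gv =
    let n , gn , vnw = detour ¬gv vw
    in bypass gm ¬gv gn mv vnw [] ◅◅ spine-move gn gw (simplex3-adj₂₃ vnw) []
  spine-path gm gw (v ∷ u ∷ p) (mv ∷ᵉ (vu ∷ᵉ path)) | no ¬gv =
    let n , gn , vnu = detour ¬gv vu
    in bypass gm ¬gv gn mv vnu (p ++ _ ∷ []) ◅◅ spine-path gn gw (u ∷ p) (simplex3-adj₂₃ vnu ∷ᵉ path)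

  good-loop-null : ∀ {v} → Good v → ∀ p → EdgePath K (v ∷ p ++ v ∷ []) → (v ∷ p ++ v ∷ []) ~ (v ∷ [])
  good-loop-null gv p path =
    ~-cancel-walk (trail gv) (p ++ _ ∷ []) [] (walk⇒edgePath (edgePath-head path) (spine gv))
      (spine-path gv gv p path)

  loop-null : ∀ v p → EdgePath K (v ∷ p ++ v ∷ []) → (v ∷ p ++ v ∷ []) ~ (v ∷ [])
  loop-null v p path with good? v
  ... | yes gv = good-loop-null gv p path
  ... | no ¬gv =
    let n , gn , vnv = detour ¬gv (adjacent-refl (edgePath-head path))
    in ~-conjugate p (simplex3-adj₁₂ vnv)
         (good-loop-null gn (v ∷ p ++ v ∷ [])
           (simplex3-adj₂₃ vnv ∷ᵉ edgePath-snoc v p path (simplex3-adj₁₂ vnv)))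

  walk-from-base : ∀ {v} → IsVertex K v → Walk base v
  walk-from-base {v} v∈ with good? v
  ... | yes gv = spine gv
  ... | no ¬gv =
    let n , gn , vnv = detour ¬gv (adjacent-refl v∈)
    in spine gn ◅◅ simplex3-adj₂₃ vnv ◅ ε

  coneRetract⇒simplyConnected : SimplyConnected K
  coneRetract⇒simplyConnected =
    (base , base-vertex) ,
    (λ u v u∈ v∈ → walk⇒path u∈ (reverse adjacent-sym (walk-from-base u∈) ◅◅ walk-from-base v∈)) ,
    loop-null

≡ᵇ-reflects-≡ : ∀ m n → Reflects (m ≡ n) (m ≡ᵇ n)
≡ᵇ-reflects-≡ m n = fromEquivalence (≡ᵇ⇒≡ m n) (≡⇒≡ᵇ m n)

<ᵇ-true : ∀ {m n} → m < n → (m <ᵇ n) ≡ true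
<ᵇ-true m<n = Equivalence.to T-≡ (<⇒<ᵇ m<n)

<ᵇ-false : ∀ {m n} → n ≤ m → (m <ᵇ n) ≡ false
<ᵇ-false {m} {n} n≤m with m <ᵇ n | <ᵇ-reflects-< m n
... | false | _       = refl
... | true  | ofʸ m<n = contradiction m<n (≤⇒≯ n≤m)

∃-avoiding : ∀ {d} (xs : List (Fin d)) → length xs < d → ∃ λ t → All (t ≢_) xs
∃-avoiding {d} xs |xs|<d with all? (λ t → any? (t ≟_) xs)
... | no ¬all =
  let t , t∉xs = ¬∀⟶∃¬ d _ (λ t → any? (t ≟_) xs) ¬all in t , ¬Any⇒All¬ xs t∉xs
... | yes all with pigeonhole |xs|<d (λ t → index (all t))
... | i , j , i<j , same = contradiction (begin
  i                          ≡⟨ lookup-index (all i) ⟩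
  lookup xs (index (all i))  ≡⟨ cong (lookup xs) same ⟩
  lookup xs (index (all j))  ≡⟨ lookup-index (all j) ⟨
  j                          ∎) (Finₚ.<⇒≢ i<j)
  where open ≡-Reasoning

<ᵇ-convex : ∀ {a b c} t → a < b → b < c → (a <ᵇ t) ≡ (c <ᵇ t) → (b <ᵇ t) ≡ (a <ᵇ t)
<ᵇ-convex {a} {b} {c} t a<b b<c eq with b <? t
... | yes b<t = trans (<ᵇ-true b<t) (sym (<ᵇ-true (<-trans a<b b<t)))
... | no  b≮t = trans (<ᵇ-false t≤b) (sym (trans eq (<ᵇ-false (≤-trans t≤b (<⇒≤ b<c)))))
  where
  t≤b : t ≤ b
  t≤b = ≮⇒≥ b≮t

%-shift-≢ : ∀ {d r k} .{{_ : NonZero d}} → r < d → 0 < k → k < d → (k + r) % d ≢ r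
%-shift-≢ {d} {r} {k} r<d 0<k k<d with k + r <? d
... | yes k+r<d = λ eq → <⇒≢ (m<n+m r 0<k) (sym (trans (sym (m<n⇒m%n≡m k+r<d)) eq))
... | no  k+r≮d = λ eq → <⇒≢ wrapped<r (trans (sym wrap) eq)
  where
  d≤k+r : d ≤ k + r
  d≤k+r = ≮⇒≥ k+r≮d
  wrapped<r : k + r ∸ d < r
  wrapped<r = subst (k + r ∸ d <_) (m+n∸m≡n d r) (∸-monoˡ-< (+-monoˡ-< r k<d) d≤k+r)
  wrap : (k + r) % d ≡ k + r ∸ d
  wrap = trans (sym (m≤n⇒[n∸m]%m≡n%m d≤k+r)) (m<n⇒m%n≡m (<-trans wrapped<r r<d))

-- The construction for any number of colours

data Unprimed : Kind → Set where
  isX : Unprimed X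
  isY : Unprimed Y

data Primed : Kind → Set where
  isX′ : Primed X′
  isY′ : Primed Y′

unprimed-irrelevant : ∀ {k} (p q : Unprimed k) → p ≡ q
unprimed-irrelevant isX isX = refl
unprimed-irrelevant isY isY = refl

unprimed? : Decidable Unprimed
unprimed? X  = yes isX
unprimed? Y  = yes isY
unprimed? X′ = no λ ()
unprimed? Y′ = no λ ()

¬unprimed⇒primed : ∀ {k} → ¬ Unprimed k → Primed k
¬unprimed⇒primed {X}  ¬u = contradiction isX ¬u
¬unprimed⇒primed {Y}  ¬u = contradiction isY ¬u
¬unprimed⇒primed {X′} _  = isX′
¬unprimed⇒primed {Y′} _  = isY′

unprimed⇒¬primed : ∀ {k} → Unprimed k → ¬ Primed k
unprimed⇒¬primed isX ()
unprimed⇒¬primed isY ()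

isXᵇ : Kind → Bool
isXᵇ X = true
isXᵇ _ = false

isXᵇ-injective : ∀ {k l} → Unprimed k → Unprimed l → isXᵇ k ≡ isXᵇ l → k ≡ l
isXᵇ-injective isX isX _ = refl
isXᵇ-injective isY isY _ = refl

module ConstructionFacts (m : ℕ) where

  D : ℕ
  D = suc m

  open Construction D public

  toℕ-ix : ∀ a → toℕ (ix a) ≡ (a + m) % D
  toℕ-ix a = toℕ-fromℕ< _

  ix-≡ : ∀ a b → (a + m) % D ≡ (b + m) % D → ix a ≡ ix b
  ix-≡ a b eq = toℕ-injective (trans (toℕ-ix a) (trans eq (sym (toℕ-ix b))))

  ix-suc-cong : ∀ {a b} → ix a ≡ ix b → ix (suc a) ≡ ix (suc b)
  ix-suc-cong {a} {b} eq = ix-≡ (suc a) (suc b) (begin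
    (1 + (a + m)) % D              ≡⟨ %-distribˡ-+ 1 (a + m) D ⟩
    (1 % D + (a + m) % D) % D      ≡⟨ cong (λ r → (1 % D + r) % D) mod-eq ⟩
    (1 % D + (b + m) % D) % D      ≡⟨ %-distribˡ-+ 1 (b + m) D ⟨
    (1 + (b + m)) % D              ∎)
    where
    open ≡-Reasoning
    mod-eq : (a + m) % D ≡ (b + m) % D
    mod-eq = trans (sym (toℕ-ix a)) (trans (cong toℕ eq) (toℕ-ix b))

  ix-periodic : ∀ a → ix (a + D) ≡ ix a
  ix-periodic zero    = ix-≡ D 0 (trans (cong (_% D) (+-comm D m)) ([m+n]%n≡m%n m D))
  ix-periodic (suc a) = ix-suc-cong (ix-periodic a)

  toℕ-ix-suc : ∀ {a} → a < D → toℕ (ix (suc a)) ≡ a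
  toℕ-ix-suc {a} a<D = begin
    toℕ (ix (suc a))   ≡⟨ toℕ-ix (suc a) ⟩
    (suc a + m) % D    ≡⟨ cong (_% D) (+-suc a m) ⟨
    (a + D) % D        ≡⟨ [m+n]%n≡m%n a D ⟩
    a % D              ≡⟨ m<n⇒m%n≡m a<D ⟩
    a                  ∎
    where open ≡-Reasoning

  ix-suc-toℕ : ∀ j → ix (suc (toℕ j)) ≡ j
  ix-suc-toℕ j = toℕ-injective (toℕ-ix-suc (toℕ<n j))

  ix-shift-≢ : ∀ a {k} → 0 < k → k < D → ix a ≢ ix (k + a)
  ix-shift-≢ a {k} 0<k k<D eq = %-shift-≢ (m%n<n (a + m) D) 0<k k<D (sym (begin
    (a + m) % D                    ≡⟨ toℕ-ix a ⟨
    toℕ (ix a)                     ≡⟨ cong toℕ eq ⟩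
    toℕ (ix (k + a))               ≡⟨ toℕ-ix (k + a) ⟩
    (k + a + m) % D                ≡⟨ cong (_% D) (+-assoc k a m) ⟩
    (k + (a + m)) % D              ≡⟨ %-distribˡ-+ k (a + m) D ⟩
    (k % D + (a + m) % D) % D      ≡⟨ cong (λ x → (x + (a + m) % D) % D) (m<n⇒m%n≡m k<D) ⟩
    (k + (a + m) % D) % D          ∎))
    where open ≡-Reasoning

  next : Fin D → Fin D
  next j = ix (suc (suc (toℕ j)))

  next-ix : ∀ a → next (ix a) ≡ ix (suc a)
  next-ix a = ix-suc-cong (ix-suc-toℕ (ix a))

  toℕ-next : ∀ {j : Fin D} → suc (toℕ j) < D → toℕ (ix (toℕ j + 2)) ≡ suc (toℕ j)
  toℕ-next {j} j+1<D = trans (cong (toℕ ∘ ix) (+-comm (toℕ j) 2)) (toℕ-ix-suc j+1<D)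

  last-colour : ∀ j → ¬ suc (toℕ j) < D → toℕ j ≡ m
  last-colour j ¬j+1<D = suc-injective (≤-antisym (toℕ<n j) (≮⇒≥ ¬j+1<D))

  ix-zero : ∀ j → ¬ suc (toℕ j) < D → ix 0 ≡ j
  ix-zero j ¬j+1<D = begin
    ix 0                 ≡⟨ ix-periodic 0 ⟨
    ix (suc m)           ≡⟨ cong (ix ∘ suc) (last-colour j ¬j+1<D) ⟨
    ix (suc (toℕ j))     ≡⟨ ix-suc-toℕ j ⟩
    j                    ∎
    where open ≡-Reasoning

  σChoice-low : ∀ {i} j → i ≤ D → σChoice i j ≡ (toℕ j <ᵇ i)
  σChoice-low {i} j i≤D with i ≤ᵇ D | ≤ᵇ-reflects-≤ i D
  ... | true  | _        = refl
  ... | false | ofⁿ i≰D = contradiction i≤D i≰D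

  σChoice-high : ∀ {i} j → D < i → σChoice i j ≡ not (toℕ j <ᵇ (i ∸ D))
  σChoice-high {i} j D<i with i ≤ᵇ D | ≤ᵇ-reflects-≤ i D
  ... | false | _        = refl
  ... | true  | ofʸ i≤D = contradiction i≤D (<⇒≱ D<i)

  σChoice-threshold : ∀ i → ∃ λ t → (∀ j → σChoice i j ≡ (toℕ j <ᵇ t))
                                   ⊎ (∀ j → σChoice i j ≡ not (toℕ j <ᵇ t))
  σChoice-threshold i with i ≤? D
  ... | yes i≤D = i , inj₁ λ j → σChoice-low j i≤D
  ... | no  i≰D = i ∸ D , inj₂ λ j → σChoice-high j (≰⇒> i≰D)

  σChoice-convex : ∀ i {a b c : Fin D} → toℕ a < toℕ b → toℕ b < toℕ c →
                   σChoice i a ≡ σChoice i c → σChoice i b ≡ σChoice i a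
  σChoice-convex i {a} {b} {c} a<b b<c eq with σChoice-threshold i
  ... | t , inj₁ σ≡ = begin
    σChoice i b      ≡⟨ σ≡ b ⟩
    (toℕ b <ᵇ t)     ≡⟨ <ᵇ-convex t a<b b<c (trans (sym (σ≡ a)) (trans eq (σ≡ c))) ⟩
    (toℕ a <ᵇ t)     ≡⟨ σ≡ a ⟨
    σChoice i a      ∎
    where open ≡-Reasoning
  ... | t , inj₂ σ≡ = let σa≡σc = trans (sym (σ≡ a)) (trans eq (σ≡ c)) in begin
    σChoice i b        ≡⟨ σ≡ b ⟩
    not (toℕ b <ᵇ t)   ≡⟨ cong not (<ᵇ-convex t a<b b<c (not-injective σa≡σc)) ⟩
    not (toℕ a <ᵇ t)   ≡⟨ σ≡ a ⟨
    σChoice i a        ∎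
    where open ≡-Reasoning

  InRange-low : ∀ j → InRange (suc (toℕ j))
  InRange-low j = s≤s z≤n , ≤-trans (toℕ<n j) (m≤m+n D (D + 0))

  InRange-high : ∀ j → InRange (D + suc (toℕ j))
  InRange-high j = s≤s z≤n , +-monoʳ-≤ D (≤-trans (toℕ<n j) (m≤m+n D 0))

  σChoice-at-low : ∀ (t j : Fin D) → σChoice (suc (toℕ t)) j ≡ (toℕ j <ᵇ suc (toℕ t))
  σChoice-at-low t j = σChoice-low j (toℕ<n t)

  σChoice-at-high : ∀ (t j : Fin D) → σChoice (D + suc (toℕ t)) j ≡ not (toℕ j <ᵇ suc (toℕ t))
  σChoice-at-high t j =
    trans (σChoice-high j (m<m+n D z<s)) (cong (λ s → not (toℕ j <ᵇ s)) (m+n∸m≡n D (suc (toℕ t))))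

  σ-realises₁ : ∀ j b → ∃ λ i → InRange i × σChoice i j ≡ b
  σ-realises₁ j true  =
    suc (toℕ j) , InRange-low j , trans (σChoice-at-low j j) (<ᵇ-true {toℕ j} ≤-refl)
  σ-realises₁ j false =
    D + suc (toℕ j) , InRange-high j , trans (σChoice-at-high j j) (cong not (<ᵇ-true {toℕ j} ≤-refl))

  σ-realises₂ : ∀ {j₁ j₂} → toℕ j₁ < toℕ j₂ → ∀ b₁ b₂ →
                ∃ λ i → InRange i × σChoice i j₁ ≡ b₁ × σChoice i j₂ ≡ b₂
  σ-realises₂ {j₁} {j₂} j₁<j₂ true true =
    suc (toℕ j₂) , InRange-low j₂ ,
    trans (σChoice-at-low j₂ j₁) (<ᵇ-true (<-trans j₁<j₂ ≤-refl)) ,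
    trans (σChoice-at-low j₂ j₂) (<ᵇ-true {toℕ j₂} ≤-refl)
  σ-realises₂ {j₁} {j₂} j₁<j₂ true false =
    suc (toℕ j₁) , InRange-low j₁ ,
    trans (σChoice-at-low j₁ j₁) (<ᵇ-true {toℕ j₁} ≤-refl) ,
    trans (σChoice-at-low j₁ j₂) (<ᵇ-false j₁<j₂)
  σ-realises₂ {j₁} {j₂} j₁<j₂ false true =
    D + suc (toℕ j₁) , InRange-high j₁ ,
    trans (σChoice-at-high j₁ j₁) (cong not (<ᵇ-true {toℕ j₁} ≤-refl)) ,
    trans (σChoice-at-high j₁ j₂) (cong not (<ᵇ-false j₁<j₂))
  σ-realises₂ {j₁} {j₂} j₁<j₂ false false =
    D + suc (toℕ j₂) , InRange-high j₂ ,
    trans (σChoice-at-high j₂ j₁) (cong not (<ᵇ-true (<-trans j₁<j₂ ≤-refl))) ,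
    trans (σChoice-at-high j₂ j₂) (cong not (<ᵇ-true {toℕ j₂} ≤-refl))

  PFacet-unprimed : ∀ {c v} → v ∈ PFacet c → Unprimed (proj₁ v)
  PFacet-unprimed {v = X , _} _ = isX
  PFacet-unprimed {v = Y , _} _ = isY

  ∈PFacet⇒ : ∀ {c k j} → Unprimed k → (k , j) ∈ PFacet c → c j ≡ isXᵇ k
  ∈PFacet⇒ isX v∈ = v∈
  ∈PFacet⇒ isY v∈ = v∈

  ∈PFacet⇐ : ∀ {c k j} → Unprimed k → c j ≡ isXᵇ k → (k , j) ∈ PFacet c
  ∈PFacet⇐ isX eq = eq
  ∈PFacet⇐ isY eq = eq

  PFacet-vertex : ∀ c j → ∃ λ k → Unprimed k × (k , j) ∈ PFacet c
  PFacet-vertex c j with c j in eq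
  ... | true  = X , isX , eq
  ... | false = Y , isY , eq

  PFacet-colour-injective : ∀ {c u w} → u ∈ PFacet c → w ∈ PFacet c → colour u ≡ colour w → u ≡ w
  PFacet-colour-injective {c} {k , j} {l , .j} u∈ w∈ refl =
    cong (_, j) (isXᵇ-injective uk ul (trans (sym (∈PFacet⇒ uk u∈)) (∈PFacet⇒ ul w∈)))
    where
    uk = PFacet-unprimed u∈
    ul = PFacet-unprimed w∈

  PFacet-⊆⇒≗ : ∀ {c c′} → PFacet c ⊆ PFacet c′ → ∀ j → c j ≡ c′ j
  PFacet-⊆⇒≗ {c} {c′} c⊆c′ j =
    let k , uk , v∈ = PFacet-vertex c j
    in trans (∈PFacet⇒ uk v∈) (sym (∈PFacet⇒ uk (c⊆c′ v∈)))

  PFacet-edge⊆σ : ∀ {c u w} → u ∈ PFacet c → w ∈ PFacet c → ∃ λ i → InRange i × u ∈ σ i × w ∈ σ i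
  PFacet-edge⊆σ {c} {k , j} {l , j′} u∈ w∈
    with <-cmp (toℕ j) (toℕ j′) | PFacet-unprimed u∈ | PFacet-unprimed w∈
  ... | tri< j<j′ _ _ | uk | ul =
    let i , range , σj , σj′ = σ-realises₂ j<j′ (isXᵇ k) (isXᵇ l)
    in i , range , ∈PFacet⇐ uk σj , ∈PFacet⇐ ul σj′
  ... | tri> _ _ j′<j | uk | ul =
    let i , range , σj′ , σj = σ-realises₂ j′<j (isXᵇ l) (isXᵇ k)
    in i , range , ∈PFacet⇐ uk σj , ∈PFacet⇐ ul σj′
  ... | tri≈ _ j≡j′ _ | uk | _ with refl ← PFacet-colour-injective u∈ w∈ (toℕ-injective j≡j′) =
    let i , range , σj = σ-realises₁ j (isXᵇ k)
    in i , range , ∈PFacet⇐ uk σj , ∈PFacet⇐ uk σj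

  nonconvex⇒∉Δ1 : ∀ {c} {a b z : Fin D} → toℕ a < toℕ b → toℕ b < toℕ z →
                  c a ≡ c z → c b ≢ c a → ¬ InΔ1 (PFacet c)
  nonconvex⇒∉Δ1 {c} {a} {b} {z} a<b b<z ca≡cz cb≢ca (i , _ , c⊆σi) =
    cb≢ca (begin
      c b            ≡⟨ σ≗ b ⟩
      σChoice i b    ≡⟨ σChoice-convex i a<b b<z (trans (sym (σ≗ a)) (trans ca≡cz (σ≗ z))) ⟩
      σChoice i a    ≡⟨ σ≗ a ⟨
      c a            ∎)
    where
    open ≡-Reasoning
    σ≗ = PFacet-⊆⇒≗ c⊆σi

  f-primed : ∀ {k} j → Unprimed k → Primed (proj₁ (f (k , j)))
  f-primed j isX with suc (toℕ j) <ᵇ D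
  ... | true  = isX′
  ... | false = isY′
  f-primed j isY with suc (toℕ j) <ᵇ D
  ... | true  = isY′
  ... | false = isX′

  colour-f : ∀ {k} j → Unprimed k → colour (f (k , j)) ≡ next j
  colour-f j isX with suc (toℕ j) <ᵇ D | <ᵇ-reflects-< (suc (toℕ j)) D
  ... | true  | _              = cong ix (+-comm (toℕ j) 2)
  ... | false | ofⁿ ¬j+1<D = sym (trans (cong (ix ∘ suc ∘ suc) (last-colour j ¬j+1<D)) (ix-periodic 1))
  colour-f j isY with suc (toℕ j) <ᵇ D | <ᵇ-reflects-< (suc (toℕ j)) D
  ... | true  | _              = cong ix (+-comm (toℕ j) 2)
  ... | false | ofⁿ ¬j+1<D = sym (trans (cong (ix ∘ suc ∘ suc) (last-colour j ¬j+1<D)) (ix-periodic 1))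

  image-PFacet-primed : ∀ {c v} → v ∈ image (PFacet c) → Primed (proj₁ v)
  image-PFacet-primed ((_ , j) , u∈ , refl) = f-primed j (PFacet-unprimed u∈)

  -- f⁻¹ on ∂P′
  hub : Vertex D → Vertex D
  hub (X′ , j) = (if toℕ j ≡ᵇ 0 then Y else X) , ix (toℕ j)
  hub (Y′ , j) = (if toℕ j ≡ᵇ 0 then X else Y) , ix (toℕ j)
  hub v        = v

  hub-unprimed : ∀ {k} j → Primed k → Unprimed (proj₁ (hub (k , j)))
  hub-unprimed j isX′ with toℕ j ≡ᵇ 0
  ... | true  = isY
  ... | false = isX
  hub-unprimed j isY′ with toℕ j ≡ᵇ 0
  ... | true  = isX
  ... | false = isY

  hub-f : ∀ {k} j → Unprimed k → hub (f (k , j)) ≡ (k , j)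
  hub-f j isX with suc (toℕ j) <ᵇ D | <ᵇ-reflects-< (suc (toℕ j)) D
  ... | true  | ofʸ j+1<D rewrite toℕ-next j+1<D = cong (X ,_) (ix-suc-toℕ j)
  ... | false | ofⁿ ¬j+1<D rewrite toℕ-ix-suc {0} z<s = cong (X ,_) (ix-zero j ¬j+1<D)
  hub-f j isY with suc (toℕ j) <ᵇ D | <ᵇ-reflects-< (suc (toℕ j)) D
  ... | true  | ofʸ j+1<D rewrite toℕ-next j+1<D = cong (Y ,_) (ix-suc-toℕ j)
  ... | false | ofⁿ ¬j+1<D rewrite toℕ-ix-suc {0} z<s = cong (Y ,_) (ix-zero j ¬j+1<D)

  ix-+D : ∀ a {b} → b ≡ a + D → ix b ≡ ix a
  ix-+D a b≡a+D = trans (cong ix b≡a+D) (ix-periodic a)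

  2D∸1≡m+D : 2 * D ∸ 1 ≡ m + D
  2D∸1≡m+D = cong (λ t → m + suc t) (+-identityʳ m)

  EdgeShape : ℕ → Vertex D × Vertex D → Set
  EdgeShape k (a , v) =
    Primed (proj₁ a) × colour a ≡ ix (suc k) × Unprimed (proj₁ v) × colour v ≡ ix (suc (suc k))

  e-shape : ∀ k → k ≤ 2 * D → EdgeShape k (e k)
  e-shape k k≤2D with k ≡ᵇ 0 | ≡ᵇ-reflects-≡ k 0
  ... | true  | ofʸ refl = isX′ , refl , isY , refl
  ... | false | ofⁿ k≢0 with k <ᵇ D ∸ 1 | <ᵇ-reflects-< k (D ∸ 1)
  ...   | true  | ofʸ _ = isX′ , cong ix (+-comm k 1) , isY , cong ix (+-comm k 2)
  ...   | false | ofⁿ k≮m with k ≡ᵇ D ∸ 1 | ≡ᵇ-reflects-≡ k (D ∸ 1)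
  ...     | true  | ofʸ refl = isX′ , refl , isX , sym (ix-periodic 1)
  ...     | false | ofⁿ k≢m with k ≡ᵇ D | ≡ᵇ-reflects-≡ k D
  ...       | true  | ofʸ refl = isY′ , sym (ix-periodic 1) , isX , sym (ix-periodic 2)
  ...       | false | ofⁿ k≢D with k <ᵇ 2 * D ∸ 1 | <ᵇ-reflects-< k (2 * D ∸ 1)
  ...         | true  | ofʸ _ =
    isY′ , sym (ix-+D (k ∸ D + 1) (wrap 1)) , isX , sym (ix-+D (k ∸ D + 2) (wrap 2))
    where
    D<k : D < k
    D<k = ≤∧≢⇒< (≤∧≢⇒< (≮⇒≥ k≮m) (k≢m ∘ sym)) (k≢D ∘ sym)
    wrap : ∀ a → a + k ≡ (k ∸ D + a) + D
    wrap a = begin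
      a + k              ≡⟨ cong (a +_) (m∸n+n≡m (<⇒≤ D<k)) ⟨
      a + (k ∸ D + D)    ≡⟨ +-assoc a (k ∸ D) D ⟨
      a + (k ∸ D) + D    ≡⟨ cong (_+ D) (+-comm a (k ∸ D)) ⟩
      k ∸ D + a + D      ∎
      where open ≡-Reasoning
  ...         | false | ofⁿ k≮2D-1 with k ≡ᵇ 2 * D ∸ 1 | ≡ᵇ-reflects-≡ k (2 * D ∸ 1)
  ...           | true  | ofʸ refl =
    isY′ , sym (ix-+D D (cong suc 2D∸1≡m+D)) ,
    isY , sym (trans (ix-+D (suc D) (cong (2 +_) 2D∸1≡m+D)) (ix-periodic 1))
  ...           | false | ofⁿ k≢2D-1 =
    isX′ , sym (trans (ix-+D (suc D) (cong suc k≡D+D)) (ix-periodic 1)) ,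
    isY , sym (trans (ix-+D (2 + D) (cong (2 +_) k≡D+D)) (ix-periodic 2))
    where
    k≡D+D : k ≡ D + D
    k≡D+D = ≤-antisym (subst (k ≤_) (cong (D +_) (+-identityʳ D)) k≤2D)
                      (subst (_< k) 2D∸1≡m+D (≤∧≢⇒< (≮⇒≥ k≮2D-1) (k≢2D-1 ∘ sym)))

  Γ-unprimed : ∀ {i b v} → Unprimed (proj₁ v) → v ∈ ΓFacet i b → v ∈ σ i × b (colour v) ≡ true
  Γ-unprimed _  (inj₁ v∈)       = v∈
  Γ-unprimed uv (inj₂ (v∈ , _)) = contradiction (image-PFacet-primed v∈) (unprimed⇒¬primed uv)

  Γ-primed : ∀ {i b v} → Primed (proj₁ v) → v ∈ ΓFacet i b → v ∈ image (σ i) × b (colour v) ≡ false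
  Γ-primed pv (inj₁ (v∈ , _)) = contradiction pv (unprimed⇒¬primed (PFacet-unprimed v∈))
  Γ-primed _  (inj₂ v∈)       = v∈

  Γ-transfer : ∀ {i b b′ v} → v ∈ ΓFacet i b → b′ (colour v) ≡ b (colour v) → v ∈ ΓFacet i b′
  Γ-transfer (inj₁ (v∈ , bv)) b′≡b = inj₁ (v∈ , trans b′≡b bv)
  Γ-transfer (inj₂ (v∈ , bv)) b′≡b = inj₂ (v∈ , trans b′≡b bv)

  Γ-avoids-e : ∀ {i b} k → k ≤ 2 * D → b (ix (suc (suc k))) ≡ false → ¬ ContainsEdge (ΓFacet i b) (e k)
  Γ-avoids-e {i} {b} k k≤2D b≡false = avoids (e k) (e-shape k k≤2D)
    where
    avoids : ∀ p → EdgeShape k p → ¬ ContainsEdge (ΓFacet i b) p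
    avoids (_ , (_ , _)) (_ , _ , uv , refl) (_ , v∈) =
      contradiction (trans (sym (proj₂ (Γ-unprimed {i} {b} uv v∈))) b≡false) λ ()

  -- Switching further colours to σ_i keeps e_k out of the facet, as long as the switch
  -- at the colour of its unprimed end forces the switch at the colour of its primed end.
  Γ-avoids-e-∨ : ∀ {i b} {P : Fin D → Set} (P? : Decidable P) k → k ≤ 2 * D →
                 (P (ix (suc (suc k))) → P (ix (suc k))) →
                 ¬ ContainsEdge (ΓFacet i b) (e k) →
                 ¬ ContainsEdge (ΓFacet i (λ j → does (P? j) ∨ b j)) (e k)
  Γ-avoids-e-∨ {i} {b} P? k k≤2D closed = avoids (e k) (e-shape k k≤2D)
    where
    b′ : Fin D → Bool
    b′ j = does (P? j) ∨ b j
    avoids : ∀ p → EdgeShape k p → ¬ ContainsEdge (ΓFacet i b) p →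
             ¬ ContainsEdge (ΓFacet i b′) p
    avoids ((_ , _) , (_ , _)) (pa , refl , uv , refl) ¬edge (a∈ , v∈)
      with P? (ix (suc (suc k))) | proj₂ (Γ-primed {i} {b′} pa a∈)
    ... | yes Pv  | b′a≡false =
      contradiction (subst (λ x → x ∨ b _ ≡ false) (dec-true (P? _) (closed Pv)) b′a≡false) λ ()
    ... | no  ¬Pv | b′a≡false =
      ¬edge (Γ-transfer {i} {b′} {b} a∈ (trans (∨-conicalʳ _ _ b′a≡false) (sym b′a≡false)) , v∈)

  mixed⇒∉Δ1∪fΔ1 : ∀ {S u w} → u ∈ S → Unprimed (proj₁ u) → w ∈ S → Primed (proj₁ w) →
                  ¬ (InΔ1 S ⊎ InfΔ1 S)
  mixed⇒∉Δ1∪fΔ1 _  _  w∈ pw (inj₁ (_ , _ , S⊆σ))  = unprimed⇒¬primed (PFacet-unprimed (S⊆σ w∈)) pw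
  mixed⇒∉Δ1∪fΔ1 u∈ uu _  _  (inj₂ (_ , _ , S⊆fσ)) = unprimed⇒¬primed uu (image-PFacet-primed (S⊆fσ u∈))

  mixed-Γ-simplex3 : ∀ {i b u w x y z} → IsΓFacet i b →
                     u ∈ ΓFacet i b → Unprimed (proj₁ u) → w ∈ ΓFacet i b → Primed (proj₁ w) →
                     x ∈ ΓFacet i b → y ∈ ΓFacet i b → z ∈ ΓFacet i b → InSimplex3 Sigma x y z
  mixed-Γ-simplex3 {i} {b} isΓ u∈ uu w∈ pw x∈ y∈ z∈ =
    inj₂ (inj₁ (i , b , isΓ , mixed⇒∉Δ1∪fΔ1 u∈ uu w∈ pw)) , x∈ , y∈ , z∈

  unprimed-adjacent⇒PFacet : ∀ {u w} → Unprimed (proj₁ u) → Unprimed (proj₁ w) → Adjacent Sigma u w →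
                             ∃ λ c → u ∈ PFacet c × w ∈ PFacet c
  unprimed-adjacent⇒PFacet _  _  (inj₁ (c , _) , u∈ , w∈) = c , u∈ , w∈
  unprimed-adjacent⇒PFacet {u} {w} uu uw (inj₂ (inj₁ (i , b , _)) , u∈ , w∈) =
    σChoice i , proj₁ (Γ-unprimed {i} {b} {u} uu u∈) , proj₁ (Γ-unprimed {i} {b} {w} uw w∈)
  unprimed-adjacent⇒PFacet uu _  (inj₂ (inj₂ _) , u∈ , _) =
    contradiction (image-PFacet-primed u∈) (unprimed⇒¬primed uu)

  -- In Γ_{k+1} the edge e_k joins colours W₀ and W₁, and e_{k+1} joins W₁ and W₂
  -- (primed end first); p is the colour of the vertex h of σ_{k+1} to be added.
  module LiftColours (3<D : 3 < D) (k : ℕ) (p : Fin D) where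

    W₀ W₁ W₂ : Fin D
    W₀ = ix (suc k)
    W₁ = ix (suc (suc k))
    W₂ = ix (suc (suc (suc k)))

    Marked : Fin D → Set
    Marked j = j ≡ p ⊎ (j ≡ W₀ × (p ≡ W₁ ⊎ p ≡ W₂)) ⊎ (j ≡ W₁ × p ≡ W₂)

    marked? : Decidable Marked
    marked? j =
      (j ≟ p) ⊎-dec ((j ≟ W₀) ×-dec ((p ≟ W₁) ⊎-dec (p ≟ W₂))) ⊎-dec ((j ≟ W₁) ×-dec (p ≟ W₂))

    1<D : 1 < D
    1<D = ≤-trans (s≤s (s≤s z≤n)) 3<D

    2<D : 2 < D
    2<D = ≤-trans (s≤s (s≤s (s≤s z≤n))) 3<D

    next-≡ : ∀ {a} → p ≡ ix a → next p ≡ ix (suc a)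
    next-≡ {a} p≡ = trans (cong next p≡) (next-ix a)

    marked-W₁⇒W₀ : Marked W₁ → Marked W₀
    marked-W₁⇒W₀ (inj₁ W₁≡p)              = inj₂ (inj₁ (refl , inj₁ (sym W₁≡p)))
    marked-W₁⇒W₀ (inj₂ (inj₁ (_ , p≡W)))  = inj₂ (inj₁ (refl , p≡W))
    marked-W₁⇒W₀ (inj₂ (inj₂ (_ , p≡W₂))) = inj₂ (inj₁ (refl , inj₂ p≡W₂))

    marked-W₂⇒W₁ : Marked W₂ → Marked W₁
    marked-W₂⇒W₁ (inj₁ W₂≡p)               = inj₂ (inj₂ (refl , sym W₂≡p))
    marked-W₂⇒W₁ (inj₂ (inj₁ (W₂≡W₀ , _))) = contradiction (sym W₂≡W₀) (ix-shift-≢ (suc k) z<s 2<D)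
    marked-W₂⇒W₁ (inj₂ (inj₂ (_ , p≡W₂)))  = inj₂ (inj₂ (refl , p≡W₂))

    next-unmarked : ¬ Marked (next p)
    next-unmarked (inj₁ np≡p) =
      ix-shift-≢ (suc (toℕ p)) z<s 1<D (trans (ix-suc-toℕ p) (sym np≡p))
    next-unmarked (inj₂ (inj₁ (np≡W₀ , inj₁ p≡W₁))) =
      ix-shift-≢ (suc k) z<s 2<D (trans (sym np≡W₀) (next-≡ p≡W₁))
    next-unmarked (inj₂ (inj₁ (np≡W₀ , inj₂ p≡W₂))) =
      ix-shift-≢ (suc k) z<s 3<D (trans (sym np≡W₀) (next-≡ p≡W₂))
    next-unmarked (inj₂ (inj₂ (np≡W₁ , p≡W₂))) =
      ix-shift-≢ (suc (suc k)) z<s 2<D (trans (sym np≡W₁) (next-≡ p≡W₂))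

  lift-simplex : 3 < D → ∀ {z a} → Unprimed (proj₁ z) → Primed (proj₁ a) → Adjacent Sigma z a →
                 InSimplex3 Sigma z (hub a) a
  lift-simplex _ _ pa (inj₁ _ , _ , a∈) =
    contradiction pa (unprimed⇒¬primed (PFacet-unprimed a∈))
  lift-simplex _ uz _ (inj₂ (inj₂ _) , z∈ , _) =
    contradiction (image-PFacet-primed z∈) (unprimed⇒¬primed uz)
  lift-simplex _ _ _ (inj₂ (inj₁ (zero , _ , ((() , _) , _) , _)) , _)
  lift-simplex 3<D {z} uz pa (inj₂ (inj₁ (suc k , b , (range , ¬e₀ , ¬e₁) , _)) , z∈ , a∈)
    with Γ-primed {suc k} {b} pa a∈
  ... | ((l , p) , h∈ , refl) , b[a]≡false rewrite hub-f p (PFacet-unprimed h∈) =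
    mixed-Γ-simplex3 isΓ′ z∈′ uz a∈′ pa z∈′ h∈′ a∈′
    where
    open LiftColours 3<D k p
    b′ : Fin D → Bool
    b′ j = does (marked? j) ∨ b j
    isΓ′ : IsΓFacet (suc k) b′
    isΓ′ = range
         , Γ-avoids-e-∨ {suc k} {b} marked? k (≤-trans (n≤1+n k) (proj₂ range)) marked-W₁⇒W₀ ¬e₀
         , Γ-avoids-e-∨ {suc k} {b} marked? (suc k) (proj₂ range) marked-W₂⇒W₁ ¬e₁
    z∈′ : z ∈ ΓFacet (suc k) b′
    z∈′ = let b[z]≡true = proj₂ (Γ-unprimed {suc k} {b} uz z∈) in
          Γ-transfer {suc k} {b} {b′} z∈
            (trans (cong (_ ∨_) b[z]≡true) (trans (∨-zeroʳ _) (sym b[z]≡true)))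
    h∈′ : (l , p) ∈ ΓFacet (suc k) b′
    h∈′ = inj₁ (h∈ , cong (_∨ b p) (dec-true (marked? p) (inj₁ refl)))
    a-unmarked : ¬ Marked (colour (f (l , p)))
    a-unmarked = subst (¬_ ∘ Marked) (sym (colour-f p (PFacet-unprimed h∈))) next-unmarked
    a∈′ : f (l , p) ∈ ΓFacet (suc k) b′
    a∈′ = inj₂ ((_ , h∈ , refl) , cong₂ _∨_ (dec-false (marked? _) a-unmarked) b[a]≡false)

-- The unprimed cone for d ≥ 5

module AtLeastFiveColours (n : ℕ) where

  open ConstructionFacts (4 + n)
  open EdgePathAlgebra Sigma

  3<D : 3 < D
  3<D = s≤s (s≤s (s≤s (s≤s z≤n)))

  4<D : 4 < D
  4<D = s≤s (s≤s (s≤s (s≤s (s≤s z≤n))))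

  bridge : ∀ {a b} → Primed (proj₁ a) → Primed (proj₁ b) → Adjacent Sigma a b →
           ∃ λ v → Unprimed (proj₁ v) × InSimplex3 Sigma a v b
  bridge pa _ (inj₁ _ , a∈ , _) = contradiction pa (unprimed⇒¬primed (PFacet-unprimed a∈))
  bridge pa pb (inj₂ (inj₁ (i , β , isΓ , ¬Δ)) , a∈ , b∈) with all? (λ j → β j Bool.≟ false)
  ... | yes all-false = ⊥-elim (¬Δ (inj₂ (i , proj₁ isΓ , ⊆image)))
    where
    ⊆image : ΓFacet i β ⊆ image (σ i)
    ⊆image (inj₁ (_ , βv≡true)) = contradiction (trans (sym βv≡true) (all-false _)) λ ()
    ⊆image (inj₂ (v∈ , _))      = v∈
  ... | no ¬all-false =
    let j , βj≢false = ¬∀⟶∃¬ D _ (λ j → β j Bool.≟ false) ¬all-false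
        k , uk , v∈σ = PFacet-vertex (σChoice i) j
    in (k , j) , uk , inj₂ (inj₁ (i , β , isΓ , ¬Δ)) , a∈ , inj₁ (v∈σ , ¬-not βj≢false) , b∈
  bridge pa pb (inj₂ (inj₂ (c , _)) , (u , u∈ , refl) , (w , w∈ , refl))
    with PFacet-edge⊆σ u∈ w∈
  ... | i , range , uσ , wσ
    with ∃-avoiding (ix (suc (suc (i ∸ 1))) ∷ ix (suc (suc i)) ∷ colour (f u) ∷ colour (f w) ∷ []) 4<D
  ... | t , t≢e₀ ∷ t≢e₁ ∷ t≢a ∷ t≢b ∷ [] with PFacet-vertex (σChoice i) t
  ... | k , uk , v∈σ = (k , t) , uk , mixed-Γ-simplex3 {i} {β} isΓ v∈ uk a∈ pa a∈ v∈ b∈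
    where
    β : Fin D → Bool
    β j = does (j ≟ t)
    isΓ : IsΓFacet i β
    isΓ = range
        , Γ-avoids-e {i} {β} (i ∸ 1) (≤-trans (m∸n≤m i 1) (proj₂ range))
                     (dec-false (_ ≟ t) (t≢e₀ ∘ sym))
        , Γ-avoids-e {i} {β} i (proj₂ range) (dec-false (_ ≟ t) (t≢e₁ ∘ sym))
    a∈ : f u ∈ ΓFacet i β
    a∈ = inj₂ ((u , uσ , refl) , dec-false (_ ≟ t) (t≢a ∘ sym))
    b∈ : f w ∈ ΓFacet i β
    b∈ = inj₂ ((w , wσ , refl) , dec-false (_ ≟ t) (t≢b ∘ sym))
    v∈ : (k , t) ∈ ΓFacet i β
    v∈ = inj₁ (v∈σ , dec-true (t ≟ t) refl)

  toℕ>0 : ∀ {t : Fin D} → t ≢ 0F → 0 < toℕ t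
  toℕ>0 t≢0 = n≢0⇒n>0 (t≢0 ∘ toℕ-injective)

  two-avoiding : ∀ (a b : Fin D) → ∃ λ r → ∃ λ s →
                 0 < toℕ r × toℕ r < toℕ s × All (r ≢_) (a ∷ b ∷ []) × All (s ≢_) (a ∷ b ∷ [])
  two-avoiding a b with ∃-avoiding (0F ∷ a ∷ b ∷ []) 3<D
  ... | r , r≢0 ∷ r≢ab with ∃-avoiding (0F ∷ a ∷ b ∷ r ∷ []) 4<D
  ... | s , s≢0 ∷ s≢a ∷ s≢b ∷ s≢r ∷ [] with <-cmp (toℕ r) (toℕ s)
  ... | tri< r<s _ _ = r , s , toℕ>0 r≢0 , r<s , r≢ab , s≢a ∷ s≢b ∷ []
  ... | tri> _ _ s<r = s , r , toℕ>0 s≢0 , s<r , s≢a ∷ s≢b ∷ [] , r≢ab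
  ... | tri≈ _ r≡s _ = contradiction (toℕ-injective (sym r≡s)) s≢r

  -- c′ keeps the choices of c at the colours of u and v, and switches back and forth at
  -- the colours 0 < r < s, so that PFacet c′ is a facet of Δ2.
  cone-simplex : ∀ {k₀ c u v} → Unprimed k₀ → u ∈ PFacet c → v ∈ PFacet c →
                 colour u ≢ 0F → colour v ≢ 0F → InSimplex3 Sigma (k₀ , 0F) u v
  cone-simplex {k₀} {c} {ku , ju} {kv , jv} uk₀ u∈ v∈ ju≢0 jv≢0 with two-avoiding ju jv
  ... | r , s , 0<r , r<s , r≢ju ∷ r≢jv ∷ [] , s≢ju ∷ s≢jv ∷ [] =
    inj₁ (c′ , nonconvex⇒∉Δ1 0<r r<s (trans c′0 (sym c′s)) c′r≢c′0) ,
    ∈PFacet⇐ uk₀ c′0 ,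
    keeps u∈ ju≢0 (r≢ju ∘ sym) (s≢ju ∘ sym) ,
    keeps v∈ jv≢0 (r≢jv ∘ sym) (s≢jv ∘ sym)
    where
    β : Bool
    β = isXᵇ k₀
    r≢s : r ≢ s
    r≢s = Finₚ.<⇒≢ r<s
    0≢r : 0F ≢ r
    0≢r = Finₚ.<⇒≢ 0<r
    c₁ c₂ c′ : Fin D → Bool
    c₁ = updateAt c 0F (const β)
    c₂ = updateAt c₁ r (const (not β))
    c′ = updateAt c₂ s (const β)
    c′s : c′ s ≡ β
    c′s = updateAt-updates s c₂
    c′r : c′ r ≡ not β
    c′r = trans (updateAt-minimal r s c₂ r≢s) (updateAt-updates r c₁)
    c′0 : c′ 0F ≡ β
    c′0 = trans (updateAt-minimal 0F s c₂ (Finₚ.<⇒≢ (<-trans 0<r r<s)))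
                (trans (updateAt-minimal 0F r c₁ 0≢r) (updateAt-updates 0F c))
    c′r≢c′0 : c′ r ≢ c′ 0F
    c′r≢c′0 eq = not-¬ refl (sym (trans (sym c′r) (trans eq c′0)))
    keeps : ∀ {k j} → (k , j) ∈ PFacet c → j ≢ 0F → j ≢ r → j ≢ s → (k , j) ∈ PFacet c′
    keeps w∈ j≢0 j≢r j≢s =
      let uk = PFacet-unprimed w∈ in
      ∈PFacet⇐ uk (trans (updateAt-minimal _ s c₂ j≢s)
                    (trans (updateAt-minimal _ r c₁ j≢r)
                      (trans (updateAt-minimal _ 0F c j≢0) (∈PFacet⇒ uk w∈))))

  cone-edge : ∀ {k₀ v} → Unprimed k₀ → Unprimed (proj₁ v) → colour v ≢ 0F →
              Adjacent Sigma (k₀ , 0F) v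
  cone-edge {v = k , j} uk₀ uk j≢0 =
    let v∈ = ∈PFacet⇐ {const (isXᵇ k)} uk refl in simplex3-adj₁₂ (cone-simplex uk₀ v∈ v∈ j≢0 j≢0)

  cone-triangle : ∀ {k₀ k l i j} → Unprimed k₀ → Unprimed k → Unprimed l →
                  i ≢ 0F → j ≢ 0F → i ≢ j → InSimplex3 Sigma (k₀ , 0F) (k , i) (l , j)
  cone-triangle {k = k} {l} {i} {j} uk₀ uk ul i≢0 j≢0 i≢j =
    cone-simplex uk₀ (∈PFacet⇐ {c} uk (updateAt-minimal i j _ i≢j)) (∈PFacet⇐ {c} ul (updateAt-updates j _))
                 i≢0 j≢0
    where
    c : Fin D → Bool
    c = updateAt (const (isXᵇ k)) j (const (isXᵇ l))

  x₁ y₁ x₂ x₃ y₂ : Vertex D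
  x₁ = X , 0F
  y₁ = Y , 0F
  x₂ = X , 1F
  x₃ = X , 2F
  y₂ = Y , 1F

  x₂—y₁ : Adjacent Sigma x₂ y₁
  x₂—y₁ = adjacent-sym (cone-edge isY isX λ ())

  spine : ∀ v → Unprimed (proj₁ v) → Walk x₁ v
  spine (_ , Fin.suc _) uv = cone-edge isX uv (λ ()) ◅ ε
  spine (X , 0F)        _  = ε
  spine (Y , 0F)        _  = cone-edge isX isX (λ ()) ◅ x₂—y₁ ◅ ε

  trail : ∀ v → Unprimed (proj₁ v) → List (Vertex D)
  trail v uv = vertices⁻ (spine v uv)

  from-y₁-far : ∀ {k j} → Unprimed k → ∀ rest →
                (x₁ ∷ x₂ ∷ y₁ ∷ (k , Fin.suc (Fin.suc j)) ∷ rest) ~ (x₁ ∷ (k , Fin.suc (Fin.suc j)) ∷ rest)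
  from-y₁-far {k} {j} uk rest = begin
    x₁ ∷ x₂ ∷ y₁ ∷ w ∷ rest   ≈⟨ ~-contract (x₁ ∷ []) rest x₂y₁w ⟩
    x₁ ∷ x₂ ∷ w ∷ rest        ≈⟨ ~-contract [] rest (cone-triangle isX isX uk (λ ()) (λ ()) (λ ())) ⟩
    x₁ ∷ w ∷ rest             ∎
    where
    w = k , Fin.suc (Fin.suc j)
    x₂y₁w : InSimplex3 Sigma x₂ y₁ w
    x₂y₁w = simplex3-swap (cone-triangle isY isX uk (λ ()) (λ ()) (λ ()))

  from-y₁ : ∀ {k j} → Unprimed k → ∀ rest →
            (x₁ ∷ x₂ ∷ y₁ ∷ (k , Fin.suc j) ∷ rest) ~ (x₁ ∷ (k , Fin.suc j) ∷ rest)
  from-y₁ {j = 0F}      isX rest = ~-backtrack (x₁ ∷ []) rest x₂—y₁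
  from-y₁ {j = 0F}      isY rest = begin
    x₁ ∷ x₂ ∷ y₁ ∷ y₂ ∷ rest        ≈⟨ ~-expand (x₁ ∷ x₂ ∷ []) rest y₁x₃y₂ ⟩
    x₁ ∷ x₂ ∷ y₁ ∷ x₃ ∷ y₂ ∷ rest   ≈⟨ from-y₁-far isX (y₂ ∷ rest) ⟩
    x₁ ∷ x₃ ∷ y₂ ∷ rest             ≈⟨ ~-contract [] rest x₁x₃y₂ ⟩
    x₁ ∷ y₂ ∷ rest                  ∎
    where
    y₁x₃y₂ : InSimplex3 Sigma y₁ x₃ y₂
    y₁x₃y₂ = cone-triangle isY isX isY (λ ()) (λ ()) (λ ())
    x₁x₃y₂ : InSimplex3 Sigma x₁ x₃ y₂
    x₁x₃y₂ = cone-triangle isX isX isY (λ ()) (λ ()) (λ ())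
  from-y₁ {j = Fin.suc _} uk  rest = from-y₁-far uk rest

  spine-move-distinct : ∀ {c} m v (um : Unprimed (proj₁ m)) (uv : Unprimed (proj₁ v)) →
                        m ∈ PFacet c → v ∈ PFacet c → colour m ≢ colour v → ∀ rest →
                        (trail m um ++ m ∷ v ∷ rest) ~ (trail v uv ++ v ∷ rest)
  spine-move-distinct (_ , 0F)      (_ , 0F)      _   _   _  _  m≢v _    = contradiction refl m≢v
  spine-move-distinct (X , 0F)      (_ , Fin.suc _) isX _  _  _  _   _    = ε
  spine-move-distinct (Y , 0F)      (_ , Fin.suc _) isY uv _  _  _   rest = from-y₁ uv rest
  spine-move-distinct (_ , Fin.suc _) (X , 0F)    um  isX _  _  _   rest =
    ~-backtrack [] rest (cone-edge isX um λ ())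
  spine-move-distinct (_ , Fin.suc _) (Y , 0F)    um  isY _  _  _   rest =
    ~-flip (x₁ ∷ x₂ ∷ []) (x₁ ∷ []) (cone-edge isY um λ ()) (from-y₁ um) rest
  spine-move-distinct (_ , Fin.suc _) (_ , Fin.suc _) _ _   m∈ v∈ _   rest =
    ~-contract [] rest (cone-simplex isX m∈ v∈ (λ ()) (λ ()))

  spine-move : ∀ {m v} (um : Unprimed (proj₁ m)) (uv : Unprimed (proj₁ v)) → Adjacent Sigma m v →
               ∀ rest → (trail m um ++ m ∷ v ∷ rest) ~ (trail v uv ++ v ∷ rest)
  spine-move {m} {v} um uv mv rest with unprimed-adjacent⇒PFacet um uv mv
  ... | c , m∈ , v∈ with colour m ≟ colour v
  ...   | no m≢v = spine-move-distinct m v um uv m∈ v∈ m≢v rest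
  ...   | yes m≡v
    with refl ← PFacet-colour-injective m∈ v∈ m≡v with refl ← unprimed-irrelevant um uv =
    ~-unstutter (trail m um) rest (adjacent⇒isVertexʳ mv)

  unprimedCone : ConeRetract Sigma
  unprimedCone = record
    { Good         = Unprimed ∘ proj₁
    ; good?        = unprimed? ∘ proj₁
    ; lift         = hub
    ; lift-good    = λ {a} ¬ua → hub-unprimed (proj₂ a) (¬unprimed⇒primed ¬ua)
    ; lift-simplex = λ um ¬ua → lift-simplex 3<D um (¬unprimed⇒primed ¬ua)
    ; bridge       = λ ¬ua ¬ub → bridge (¬unprimed⇒primed ¬ua) (¬unprimed⇒primed ¬ub)
    ; base         = x₁
    ; base-vertex  = adjacent⇒isVertexˡ (cone-edge {v = x₂} isX isX λ ())
    ; spine        = λ {v} → spine v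
    ; spine-move   = λ {m} {v} → spine-move {m} {v}
    }

lemma4p4 : (d : ℕ) .{{_ : NonZero d}} → 5 ≤ d → SimplyConnected (Construction.Sigma d)
lemma4p4 _ (s≤s (s≤s (s≤s (s≤s (s≤s (z≤n {n})))))) =
  coneRetract⇒simplyConnected (AtLeastFiveColours.unprimedCone n)
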